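{- Let $T$ be an $(r\times c, v)$-near triple array with parameters $e=rc/v$, $\lambda_{rc},\lambda_{rr},\lambda_{cc}$. Then the following are equivalent: (a) $e\le 2$, $\lambda_{rc}\le 2$ and $\lambda_{cc}\le 1$; (b) $v \geq rc - c\cdot\min(r, c-1)/2$.
   Context: An $r\times c$ row-column design on $v$ symbols is an $r\times c$ array each of whose cells is filled with one of $v$ symbols. It is binary if no symbol occurs more than once in any row or in any column. Let $e=rc/v$, $e^-=\lfloor e\rfloor$, $e^+=\lceil e\rceil$. The design is equireplicate if $e$ is an integer and every symbol occurs exactly $e$ times, and near equireplicate if $e$ is not an integer and every symbol occurs $e^-$ or $e^+$ times. For a binary design with $r,c\ge2$, let $R_i$, $C_j$ be the symbol sets of row $i$ and column $j$, and put $\lambda_{rc}=\frac{1}{rc}\sum_{i,j}|R_i\cap C_j|$, $\lambda_{rr}=\binom{r}{2}^{ -1}\sum_{i<j}|R_i\cap R_j|$, $\lambda_{cc}=\binom{c}{2}^{ -1}\sum_{i<j}|C_i\cap C_j|$; for real $x$, $x^-=\lfloor x\rfloor$, $x^+=\lceil x\rceil$. An $(r\times c,v)$-near triple array is a binary $r\times c$ row-column design on $v$ symbols which is equireplicate or near equireplicate and in which every row and column share $\lambda_{rc}^-$ or $\lambda_{rc}^+$ symbols, every two distinct rows share $\lambda_{rr}^-$ or $\lambda_{rr}^+$ symbols, and every two distinct columns share $\lambda_{cc}^-$ or $\lambda_{cc}^+$ symbols. -}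

module Defs where

open import Data.Nat using (ℕ; zero; suc; _+_; _*_; _∸_; _≤_; _⊓_)
import Data.Nat as N
open import Data.Nat.Combinatorics using (_C_)
open import Data.Fin using (Fin; zero; suc; _<?_)
import Data.Fin as F
open import Data.Fin.Subset using (Subset; ⁅_⁆; ⋃; _∩_; ∣_∣)
open import Data.List using (List; tabulate)
open import Data.Bool using (if_then_else_)
open import Data.Product using (_×_; Σ)
open import Data.Sum using (_⊎_)
open import Relation.Binary.PropositionalEquality using (_≡_; _≢_)
open import Relation.Nullary.Decidable using (⌊_⌋)

Design : ℕ → ℕ → ℕ → Set
Design r c v = Fin r → Fin c → Fin v

sumFin : (n : ℕ) → (Fin n → ℕ) → ℕ
sumFin zero    f = 0
sumFin (suc n) f = f zero + sumFin n (λ i → f (suc i))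

-- floor and ceiling of the rational number S / N (N > 0; value 0 for N = 0, never used)
floorQ : ℕ → ℕ → ℕ
floorQ S zero    = 0
floorQ S (suc k) = S N./ suc k

ceilQ : ℕ → ℕ → ℕ
ceilQ S zero    = 0
ceilQ S (suc k) = (S + k) N./ suc k

FloorOrCeil : ℕ → ℕ → ℕ → Set
FloorOrCeil x S N = (x ≡ floorQ S N) ⊎ (x ≡ ceilQ S N)

module _ {r c v : ℕ} (T : Design r c v) where

  Binary : Set
  Binary = (∀ i j j′ → T i j ≡ T i j′ → j ≡ j′)
         × (∀ i i′ j → T i j ≡ T i′ j → i ≡ i′)

  replication : Fin v → ℕ
  replication s = sumFin r (λ i → sumFin c (λ j → if ⌊ T i j F.≟ s ⌋ then 1 else 0))

  Equireplicate : Set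
  Equireplicate = Σ ℕ (λ e → (r * c ≡ e * v) × (∀ s → replication s ≡ e))

  NearEquireplicate : Set
  NearEquireplicate = (∀ e → r * c ≢ e * v)
                    × (∀ s → FloorOrCeil (replication s) (r * c) v)

  rowSet : Fin r → Subset v
  rowSet i = ⋃ (tabulate (λ j → ⁅ T i j ⁆))

  colSet : Fin c → Subset v
  colSet j = ⋃ (tabulate (λ i → ⁅ T i j ⁆))

  -- Σ_{i,j} |R_i ∩ C_j|   (λ_rc = sumRC / (r c))
  sumRC : ℕ
  sumRC = sumFin r (λ i → sumFin c (λ j → ∣ rowSet i ∩ colSet j ∣))

  -- Σ_{i<j} |R_i ∩ R_j|   (λ_rr = sumRR / (r choose 2))
  sumRR : ℕ
  sumRR = sumFin r (λ i → sumFin r (λ j →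
            if ⌊ i <? j ⌋ then ∣ rowSet i ∩ rowSet j ∣ else 0))

  -- Σ_{i<j} |C_i ∩ C_j|   (λ_cc = sumCC / (c choose 2))
  sumCC : ℕ
  sumCC = sumFin c (λ i → sumFin c (λ j →
            if ⌊ i <? j ⌋ then ∣ colSet i ∩ colSet j ∣ else 0))

  NearTripleArray : Set
  NearTripleArray =
      Binary
    × (Equireplicate ⊎ NearEquireplicate)
    × (∀ i j → FloorOrCeil ∣ rowSet i ∩ colSet j ∣ sumRC (r * c))
    × (∀ i i′ → i ≢ i′ → FloorOrCeil ∣ rowSet i ∩ rowSet i′ ∣ sumRR (r C 2))
    × (∀ j j′ → j ≢ j′ → FloorOrCeil ∣ colSet j ∩ colSet j′ ∣ sumCC (c C 2))

  -- (a): e ≤ 2, λ_rc ≤ 2, λ_cc ≤ 1 (rational inequalities, denominators cleared)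
  ConditionA : Set
  ConditionA = (r * c ≤ 2 * v) × (sumRC ≤ 2 * (r * c)) × (sumCC ≤ c C 2)

  -- (b): v ≥ rc − c·min(r, c−1)/2 (multiplied by 2, rearranged to avoid truncated subtraction)
  ConditionB : Set
  ConditionB = 2 * (r * c) ≤ 2 * v + c * (r ⊓ (c ∸ 1))

-- Count everything over the symbols.  If ρ s is the number of occurrences of s, then
-- Σ ρ s = rc, and since in a binary array s lies in exactly ρ s rows and ρ s columns,
-- Σ_{i,j} |R_i ∩ C_j| = Σ ρ s² and Σ_{j<j′} |C_j ∩ C_j′| = Σ C(ρ s, 2).
-- Splitting the minimum, (b) says exactly rc ≤ 2v and rc ≤ v + C(c,2).
-- (a) ⇒ (b): ρ ≤ 1 + C(ρ,2) gives rc ≤ v + Σ C(ρ s, 2) ≤ v + C(c,2).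
-- (b) ⇒ (a): rc ≤ 2v and (near) equireplication force ρ s ≤ 2, hence Σ ρ s² ≤ 2rc; moreover
-- either every ρ s ≤ 1, so no two columns meet, or every ρ s ∈ {1, 2}, so
-- v + Σ C(ρ s, 2) = rc ≤ v + C(c,2).
-- Only binarity and (near) equireplication of the near triple array are needed.

module Submission where

open import Defs
open import Data.Bool using (Bool; true; false; if_then_else_; _∧_; _∨_)
open import Data.Fin using (Fin; zero; suc; _<?_; _≟_; punchIn)
open import Data.Fin.Properties using (punchInᵢ≢i; suc-injective; 0≢1+n; ¬Fin0)
open import Data.Fin.Subset using (Subset; ⁅_⁆; ⋃; _∩_; ∣_∣; outside)
open import Data.List using (tabulate)
open import Data.Nat using (ℕ; zero; suc; _+_; _*_; _∸_; _⊓_; _≤_; z≤n; s≤s; _≤?_; _/_)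
open import Data.Nat.Combinatorics using (_C_; nC1≡n; nCk+nC[k+1]≡[n+1]C[k+1])
open import Data.Nat.DivMod using (/-monoˡ-≤; m<n*o⇒m/o<n; m*n/n≡m)
open import Data.Nat.Properties hiding (_<?_; _≟_; 0≢1+n; suc-injective)
open import Data.Nat.Tactic.RingSolver using (solve-∀)
open import Data.Product using (_×_; _,_; proj₁; proj₂; uncurry)
open import Data.Sum using (_⊎_; inj₁; inj₂; [_,_]′)
open import Data.Vec using ([]; _∷_; lookup)
open import Data.Vec.Properties using (lookup-replicate; lookup-zipWith)
open import Function using (_∘_)
open import Function.Bundles using (_⇔_; mk⇔; Equivalence)
open import Function.Construct.Composition using (_⇔-∘_)
open import Function.Construct.Symmetry using (⇔-sym)
open import Function.Definitions using (Injective)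
open import Relation.Binary.PropositionalEquality
open import Relation.Nullary.Decidable using (Dec; does; ⌊_⌋; yes; no; isYes≗does; does-⇔)
open import Relation.Nullary.Negation using (contradiction)

open import Algebra.Properties.Semiring.Sum +-*-semiring
  using (sum; sum-syntax; sum-cong-≗; sum-replicate-zero; sum-remove; ∑-comm; ∑-distrib-+;
         *-distribˡ-sum; *-distribʳ-sum)

sumFin≡sum : ∀ n (f : Fin n → ℕ) → sumFin n f ≡ sum f
sumFin≡sum zero    f = refl
sumFin≡sum (suc n) f = cong (f zero +_) (sumFin≡sum n (f ∘ suc))

sumFin²≡∑∑ : ∀ m n (f : Fin m → Fin n → ℕ) →
  sumFin m (λ i → sumFin n (f i)) ≡ ∑[ i < m ] ∑[ j < n ] f i j
sumFin²≡∑∑ m n f = trans (sumFin≡sum m _) (sum-cong-≗ (λ i → sumFin≡sum n (f i)))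

sum-mono-≤ : ∀ {n} {f g : Fin n → ℕ} → (∀ i → f i ≤ g i) → sum f ≤ sum g
sum-mono-≤ {zero}  f≤g = z≤n
sum-mono-≤ {suc n} f≤g = +-mono-≤ (f≤g zero) (sum-mono-≤ (f≤g ∘ suc))

sum-zero : ∀ {n} {f : Fin n → ℕ} → (∀ i → f i ≡ 0) → sum f ≡ 0
sum-zero {n} f≡0 = trans (sum-cong-≗ f≡0) (sum-replicate-zero n)

sum-const : ∀ n k → ∑[ i < n ] k ≡ n * k
sum-const zero    k = refl
sum-const (suc n) k = cong (k +_) (sum-const n k)

∑[1+x]≡n+∑x : ∀ {n} (x : Fin n → ℕ) → ∑[ i < n ] (1 + x i) ≡ n + sum x
∑[1+x]≡n+∑x {n} x =
  trans (∑-distrib-+ (λ _ → 1) x) (cong (_+ sum x) (trans (sum-const n 1) (*-identityʳ n)))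

⌊⌋-⇔ : ∀ {a b} {A : Set a} {B : Set b} →
  A ⇔ B → (a? : Dec A) (b? : Dec B) → ⌊ a? ⌋ ≡ ⌊ b? ⌋
⌊⌋-⇔ A⇔B a? b? = trans (isYes≗does a?) (trans (does-⇔ A⇔B a? b?) (sym (isYes≗does b?)))

-- ⌊_⌋ is isYes, which is stuck on map′, so this is not refl.
suc<?suc : ∀ {n} (i j : Fin n) → ⌊ suc i <? suc j ⌋ ≡ ⌊ i <? j ⌋
suc<?suc i j = ⌊⌋-⇔ (mk⇔ ≤-pred s≤s) (suc i <? suc j) (i <? j)

indicator : Bool → ℕ
indicator b = if b then 1 else 0

indicator≤1 : ∀ b → indicator b ≤ 1
indicator≤1 true  = ≤-refl
indicator≤1 false = z≤n

indicator-∧ : ∀ a b → indicator (a ∧ b) ≡ indicator a * indicator b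
indicator-∧ true  b = sym (+-identityʳ (indicator b))
indicator-∧ false b = refl

δ : ∀ {n} → Fin n → Fin n → ℕ
δ x s = indicator ⌊ x ≟ s ⌋

δ-refl : ∀ {n} (x : Fin n) → δ x x ≡ 1
δ-refl x with x ≟ x
... | yes _   = refl
... | no x≢x = contradiction refl x≢x

δ-≢ : ∀ {n} {x s : Fin n} → x ≢ s → δ x s ≡ 0
δ-≢ {x = x} {s} x≢s with x ≟ s
... | yes x≡s = contradiction x≡s x≢s
... | no _    = refl

sum-δ : ∀ {n} (x : Fin n) → ∑[ s < n ] δ x s ≡ 1
sum-δ {suc n} x = begin
  ∑[ s < suc n ] δ x s
    ≡⟨ sum-remove {i = x} (δ x) ⟩
  δ x x + ∑[ k < n ] δ x (punchIn x k)
    ≡⟨ cong₂ _+_ (δ-refl x) (sum-zero (λ k → δ-≢ (punchInᵢ≢i x k ∘ sym))) ⟩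
  1
    ∎
  where open ≡-Reasoning

[_∈_] : ∀ {n} → Fin n → Subset n → ℕ
[ s ∈ p ] = indicator (lookup p s)

∣p∣≡∑ : ∀ {n} (p : Subset n) → ∣ p ∣ ≡ ∑[ s < n ] [ s ∈ p ]
∣p∣≡∑ []          = refl
∣p∣≡∑ (true ∷ p)  = cong suc (∣p∣≡∑ p)
∣p∣≡∑ (false ∷ p) = ∣p∣≡∑ p

∣p∩q∣≡∑ : ∀ {n} (p q : Subset n) → ∣ p ∩ q ∣ ≡ ∑[ s < n ] ([ s ∈ p ] * [ s ∈ q ])
∣p∩q∣≡∑ p q = trans (∣p∣≡∑ (p ∩ q)) (sum-cong-≗ λ s →
  trans (cong indicator (lookup-zipWith _∧_ s p q)) (indicator-∧ (lookup p s) (lookup q s)))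

lookup-⁅⁆ : ∀ {n} (x s : Fin n) → lookup ⁅ x ⁆ s ≡ does (x ≟ s)
lookup-⁅⁆ zero    zero    = refl
lookup-⁅⁆ zero    (suc s) = lookup-replicate s outside
lookup-⁅⁆ (suc x) zero    = refl
lookup-⁅⁆ (suc x) (suc s) = lookup-⁅⁆ x s

[∈⋃⁅⁆] : ∀ {n v} (g : Fin n → Fin v) → Injective _≡_ _≡_ g → ∀ s →
  [ s ∈ ⋃ (tabulate (λ j → ⁅ g j ⁆)) ] ≡ ∑[ j < n ] δ (g j) s
[∈⋃⁅⁆] {zero}  g g-inj s = cong indicator (lookup-replicate s outside)
[∈⋃⁅⁆] {suc n} g g-inj s
  rewrite lookup-zipWith _∨_ s ⁅ g zero ⁆ (⋃ (tabulate (λ j → ⁅ g (suc j) ⁆)))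
        | lookup-⁅⁆ (g zero) s
  with g zero ≟ s
... | yes refl = cong suc (sym (sum-zero {n} (λ j → δ-≢ (0≢1+n ∘ sym ∘ g-inj))))
... | no _     = [∈⋃⁅⁆] (g ∘ suc) (suc-injective ∘ g-inj) s

[1+n]C2≡n+nC2 : ∀ n → suc n C 2 ≡ n + n C 2
[1+n]C2≡n+nC2 n = trans (sym (nCk+nC[k+1]≡[n+1]C[k+1] n 1)) (cong (_+ n C 2) (nC1≡n n))

b*n+nC2≡[b+n]C2 : ∀ {b} n → b ≤ 1 → b * n + n C 2 ≡ (b + n) C 2
b*n+nC2≡[b+n]C2 n z≤n       = refl
b*n+nC2≡[b+n]C2 n (s≤s z≤n) = trans (cong (_+ n C 2) (*-identityˡ n)) (sym ([1+n]C2≡n+nC2 n))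

n≤1+nC2 : ∀ n → n ≤ 1 + n C 2
n≤1+nC2 zero    = z≤n
n≤1+nC2 (suc n) = s≤s (≤-trans (m≤m+n n (n C 2)) (≤-reflexive (sym ([1+n]C2≡n+nC2 n))))

1+nC2≡n : ∀ {n} → 1 ≤ n → n ≤ 2 → 1 + n C 2 ≡ n
1+nC2≡n {1} _ _ = refl
1+nC2≡n {2} _ _ = refl
1+nC2≡n {suc (suc (suc _))} _ (s≤s (s≤s ()))

n≤1⇒nC2≡0 : ∀ {n} → n ≤ 1 → n C 2 ≡ 0
n≤1⇒nC2≡0 z≤n       = refl
n≤1⇒nC2≡0 (s≤s z≤n) = refl

pairSum : ∀ n → (Fin n → Fin n → ℕ) → ℕ
pairSum n f = ∑[ i < n ] ∑[ j < n ] (if ⌊ i <? j ⌋ then f i j else 0)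

pairSum-suc : ∀ n (f : Fin (suc n) → Fin (suc n) → ℕ) →
  pairSum (suc n) f ≡ ∑[ j < n ] f zero (suc j) + pairSum n (λ i j → f (suc i) (suc j))
pairSum-suc n f = cong (∑[ j < n ] f zero (suc j) +_) (sum-cong-≗ λ i → sum-cong-≗ λ j →
  cong (λ b → if b then f (suc i) (suc j) else 0) (suc<?suc i j))

pairSum-cong : ∀ n {f g : Fin n → Fin n → ℕ} →
  (∀ i j → f i j ≡ g i j) → pairSum n f ≡ pairSum n g
pairSum-cong n f≡g =
  sum-cong-≗ λ i → sum-cong-≗ λ j → cong (if ⌊ i <? j ⌋ then_else 0) (f≡g i j)

if-sum : ∀ {n} b (f : Fin n → ℕ) →
  (if b then sum f else 0) ≡ ∑[ s < n ] (if b then f s else 0)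
if-sum {n} true  f = refl
if-sum {n} false f = sym (sum-replicate-zero n)

pairSum-∑ : ∀ n v (f : Fin n → Fin n → Fin v → ℕ) →
  pairSum n (λ i j → ∑[ s < v ] f i j s) ≡ ∑[ s < v ] pairSum n (λ i j → f i j s)
pairSum-∑ n v f = begin
  ∑[ i < n ] ∑[ j < n ] (if ⌊ i <? j ⌋ then ∑[ s < v ] f i j s else 0)
    ≡⟨ sum-cong-≗ (λ i → sum-cong-≗ λ j → if-sum ⌊ i <? j ⌋ (f i j)) ⟩
  ∑[ i < n ] ∑[ j < n ] ∑[ s < v ] g i j s
    ≡⟨ sum-cong-≗ (λ i → ∑-comm (g i)) ⟩
  ∑[ i < n ] ∑[ s < v ] ∑[ j < n ] g i j s
    ≡⟨ ∑-comm (λ i s → ∑[ j < n ] g i j s) ⟩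
  ∑[ s < v ] pairSum n (λ i j → f i j s)
    ∎
  where
  open ≡-Reasoning
  g : Fin n → Fin n → Fin v → ℕ
  g i j s = if ⌊ i <? j ⌋ then f i j s else 0

pairSum-bits : ∀ n (x : Fin n → ℕ) → (∀ i → x i ≤ 1) →
  pairSum n (λ i j → x i * x j) ≡ sum x C 2
pairSum-bits zero    x x≤1 = refl
pairSum-bits (suc n) x x≤1 = begin
  pairSum (suc n) (λ i j → x i * x j)
    ≡⟨ pairSum-suc n (λ i j → x i * x j) ⟩
  ∑[ j < n ] (x zero * x (suc j)) + pairSum n (λ i j → x (suc i) * x (suc j))
    ≡⟨ cong₂ _+_ (sym (*-distribˡ-sum (x zero) (x ∘ suc)))
                 (pairSum-bits n (x ∘ suc) (x≤1 ∘ suc)) ⟩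
  x zero * sum (x ∘ suc) + sum (x ∘ suc) C 2
    ≡⟨ b*n+nC2≡[b+n]C2 (sum (x ∘ suc)) (x≤1 zero) ⟩
  sum x C 2
    ∎
  where open ≡-Reasoning

∑∑∑[a*b]≡∑[∑a*∑b] : ∀ m n v (a : Fin m → Fin v → ℕ) (b : Fin n → Fin v → ℕ) →
  ∑[ i < m ] ∑[ j < n ] ∑[ s < v ] (a i s * b j s) ≡
  ∑[ s < v ] (∑[ i < m ] a i s * ∑[ j < n ] b j s)
∑∑∑[a*b]≡∑[∑a*∑b] m n v a b = begin
  ∑[ i < m ] ∑[ j < n ] ∑[ s < v ] (a i s * b j s)
    ≡⟨ sum-cong-≗ (λ i → ∑-comm (λ j s → a i s * b j s)) ⟩
  ∑[ i < m ] ∑[ s < v ] ∑[ j < n ] (a i s * b j s)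
    ≡⟨ ∑-comm (λ i s → ∑[ j < n ] (a i s * b j s)) ⟩
  ∑[ s < v ] ∑[ i < m ] ∑[ j < n ] (a i s * b j s)
    ≡⟨ sum-cong-≗ (λ s → sum-cong-≗ λ i → *-distribˡ-sum (a i s) (λ j → b j s)) ⟨
  ∑[ s < v ] ∑[ i < m ] (a i s * ∑[ j < n ] b j s)
    ≡⟨ sum-cong-≗ (λ s → *-distribʳ-sum (∑[ j < n ] b j s) (λ i → a i s)) ⟨
  ∑[ s < v ] (∑[ i < m ] a i s * ∑[ j < n ] b j s)
    ∎
  where open ≡-Reasoning

module _ {r c v : ℕ} (T : Design r c v) where

  replication≡∑∑δ : ∀ s → replication T s ≡ ∑[ i < r ] ∑[ j < c ] δ (T i j) s
  replication≡∑∑δ s = sumFin²≡∑∑ r c (λ i j → δ (T i j) s)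

  ∑replication≡rc : ∑[ s < v ] replication T s ≡ r * c
  ∑replication≡rc = begin
    ∑[ s < v ] replication T s
      ≡⟨ sum-cong-≗ replication≡∑∑δ ⟩
    ∑[ s < v ] ∑[ i < r ] ∑[ j < c ] δ (T i j) s
      ≡⟨ ∑-comm (λ s i → ∑[ j < c ] δ (T i j) s) ⟩
    ∑[ i < r ] ∑[ s < v ] ∑[ j < c ] δ (T i j) s
      ≡⟨ sum-cong-≗ (λ i → ∑-comm (λ s j → δ (T i j) s)) ⟩
    ∑[ i < r ] ∑[ j < c ] ∑[ s < v ] δ (T i j) s
      ≡⟨ sum-cong-≗ (λ i → sum-cong-≗ λ j → sum-δ (T i j)) ⟩
    ∑[ i < r ] ∑[ j < c ] 1
      ≡⟨ sum-cong-≗ {r} (λ i → trans (sum-const c 1) (*-identityʳ c)) ⟩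
    ∑[ i < r ] c
      ≡⟨ sum-const r c ⟩
    r * c
      ∎
    where open ≡-Reasoning

  module _ (binary : Binary T) where

    ∑[∈rowSet]≡replication : ∀ s → ∑[ i < r ] [ s ∈ rowSet T i ] ≡ replication T s
    ∑[∈rowSet]≡replication s =
      trans (sum-cong-≗ λ i → [∈⋃⁅⁆] (T i) (proj₁ binary i _ _) s) (sym (replication≡∑∑δ s))

    ∑[∈colSet]≡replication : ∀ s → ∑[ j < c ] [ s ∈ colSet T j ] ≡ replication T s
    ∑[∈colSet]≡replication s = begin
      ∑[ j < c ] [ s ∈ colSet T j ]
        ≡⟨ sum-cong-≗ (λ j → [∈⋃⁅⁆] (λ i → T i j) (proj₂ binary _ _ j) s) ⟩
      ∑[ j < c ] ∑[ i < r ] δ (T i j) s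
        ≡⟨ ∑-comm (λ j i → δ (T i j) s) ⟩
      ∑[ i < r ] ∑[ j < c ] δ (T i j) s
        ≡⟨ replication≡∑∑δ s ⟨
      replication T s
        ∎
      where open ≡-Reasoning

    sumRC≡∑ρ² : sumRC T ≡ ∑[ s < v ] (replication T s * replication T s)
    sumRC≡∑ρ² = begin
      sumRC T
        ≡⟨ sumFin²≡∑∑ r c (λ i j → ∣ rowSet T i ∩ colSet T j ∣) ⟩
      ∑[ i < r ] ∑[ j < c ] ∣ rowSet T i ∩ colSet T j ∣
        ≡⟨ sum-cong-≗ (λ i → sum-cong-≗ λ j → ∣p∩q∣≡∑ (rowSet T i) (colSet T j)) ⟩
      ∑[ i < r ] ∑[ j < c ] ∑[ s < v ] ([ s ∈ rowSet T i ] * [ s ∈ colSet T j ])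
        ≡⟨ ∑∑∑[a*b]≡∑[∑a*∑b] r c v (λ i s → [ s ∈ rowSet T i ]) (λ j s → [ s ∈ colSet T j ]) ⟩
      ∑[ s < v ] (∑[ i < r ] [ s ∈ rowSet T i ] * ∑[ j < c ] [ s ∈ colSet T j ])
        ≡⟨ sum-cong-≗ (λ s → cong₂ _*_ (∑[∈rowSet]≡replication s) (∑[∈colSet]≡replication s)) ⟩
      ∑[ s < v ] (replication T s * replication T s)
        ∎
      where open ≡-Reasoning

    sumCC≡∑ρC2 : sumCC T ≡ ∑[ s < v ] (replication T s C 2)
    sumCC≡∑ρC2 = begin
      sumCC T
        ≡⟨ sumFin²≡∑∑ c c _ ⟩
      pairSum c (λ j j′ → ∣ colSet T j ∩ colSet T j′ ∣)
        ≡⟨ pairSum-cong c (λ j j′ → ∣p∩q∣≡∑ (colSet T j) (colSet T j′)) ⟩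
      pairSum c (λ j j′ → ∑[ s < v ] ([ s ∈ colSet T j ] * [ s ∈ colSet T j′ ]))
        ≡⟨ pairSum-∑ c v (λ j j′ s → [ s ∈ colSet T j ] * [ s ∈ colSet T j′ ]) ⟩
      ∑[ s < v ] pairSum c (λ j j′ → [ s ∈ colSet T j ] * [ s ∈ colSet T j′ ])
        ≡⟨ sum-cong-≗ (λ s → pairSum-bits c (λ j → [ s ∈ colSet T j ]) (λ j → indicator≤1 _)) ⟩
      ∑[ s < v ] (∑[ j < c ] [ s ∈ colSet T j ] C 2)
        ≡⟨ sum-cong-≗ (λ s → cong (_C 2) (∑[∈colSet]≡replication s)) ⟩
      ∑[ s < v ] (replication T s C 2)
        ∎
      where open ≡-Reasoning

    rc≤v+sumCC : r * c ≤ v + sumCC T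
    rc≤v+sumCC = begin
      r * c
        ≡⟨ ∑replication≡rc ⟨
      ∑[ s < v ] replication T s
        ≤⟨ sum-mono-≤ (λ s → n≤1+nC2 (replication T s)) ⟩
      ∑[ s < v ] (1 + replication T s C 2)
        ≡⟨ ∑[1+x]≡n+∑x (λ s → replication T s C 2) ⟩
      v + ∑[ s < v ] (replication T s C 2)
        ≡⟨ cong (v +_) sumCC≡∑ρC2 ⟨
      v + sumCC T
        ∎
      where open ≤-Reasoning

    sumRC≤2rc : (∀ s → replication T s ≤ 2) → sumRC T ≤ 2 * (r * c)
    sumRC≤2rc ρ≤2 = begin
      sumRC T
        ≡⟨ sumRC≡∑ρ² ⟩
      ∑[ s < v ] (replication T s * replication T s)
        ≤⟨ sum-mono-≤ (λ s → *-monoˡ-≤ (replication T s) (ρ≤2 s)) ⟩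
      ∑[ s < v ] (2 * replication T s)
        ≡⟨ *-distribˡ-sum 2 (replication T) ⟨
      2 * ∑[ s < v ] replication T s
        ≡⟨ cong (2 *_) ∑replication≡rc ⟩
      2 * (r * c)
        ∎
      where open ≤-Reasoning

    sumCC≡0 : (∀ s → replication T s ≤ 1) → sumCC T ≡ 0
    sumCC≡0 ρ≤1 = trans sumCC≡∑ρC2 (sum-zero (λ s → n≤1⇒nC2≡0 (ρ≤1 s)))

    v+sumCC≡rc : (∀ s → 1 ≤ replication T s) → (∀ s → replication T s ≤ 2) →
      v + sumCC T ≡ r * c
    v+sumCC≡rc 1≤ρ ρ≤2 = begin
      v + sumCC T
        ≡⟨ cong (v +_) sumCC≡∑ρC2 ⟩
      v + ∑[ s < v ] (replication T s C 2)
        ≡⟨ ∑[1+x]≡n+∑x (λ s → replication T s C 2) ⟨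
      ∑[ s < v ] (1 + replication T s C 2)
        ≡⟨ sum-cong-≗ (λ s → 1+nC2≡n (1≤ρ s) (ρ≤2 s)) ⟩
      ∑[ s < v ] replication T s
        ≡⟨ ∑replication≡rc ⟩
      r * c
        ∎
      where open ≡-Reasoning

floor≤ceil : ∀ S n → floorQ S (suc n) ≤ ceilQ S (suc n)
floor≤ceil S n = /-monoˡ-≤ (suc n) (m≤m+n S n)

ceilQ≤ : ∀ {S n} k → S ≤ k * suc n → ceilQ S (suc n) ≤ k
ceilQ≤ {S} {n} k S≤kN = ≤-pred (m<n*o⇒m/o<n (begin-strict
  S + n              <⟨ +-mono-≤-< S≤kN (n<1+n n) ⟩
  k * suc n + suc n  ≡⟨ +-comm (k * suc n) (suc n) ⟩
  suc k * suc n      ∎))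
  where open ≤-Reasoning

≤floorQ : ∀ {S n} k → k * suc n ≤ S → k ≤ floorQ S (suc n)
≤floorQ {S} {n} k kN≤S =
  subst (_≤ S / suc n) (m*n/n≡m k (suc n)) (/-monoˡ-≤ (suc n) kN≤S)

floorOrCeil-≤ : ∀ {x S n} k → S ≤ k * suc n → FloorOrCeil x S (suc n) → x ≤ k
floorOrCeil-≤ {S = S} {n} k S≤kN (inj₁ refl) = ≤-trans (floor≤ceil S n) (ceilQ≤ k S≤kN)
floorOrCeil-≤ k S≤kN (inj₂ refl) = ceilQ≤ k S≤kN

floorOrCeil-≥ : ∀ {x S n} k → k * suc n ≤ S → FloorOrCeil x S (suc n) → k ≤ x
floorOrCeil-≥ k kN≤S (inj₁ refl) = ≤floorQ k kN≤S
floorOrCeil-≥ {S = S} {n} k kN≤S (inj₂ refl) = ≤-trans (≤floorQ k kN≤S) (floor≤ceil S n)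

equireplicate⇒floorOrCeil : ∀ {r c n} (T : Design r c (suc n)) → Equireplicate T →
  ∀ s → FloorOrCeil (replication T s) (r * c) (suc n)
equireplicate⇒floorOrCeil {r} {c} {n} T (e , rc≡e*v , ρ≡e) s = inj₁ (begin
  replication T s     ≡⟨ ρ≡e s ⟩
  e                   ≡⟨ m*n/n≡m e (suc n) ⟨
  e * suc n / suc n   ≡⟨ cong (_/ suc n) rc≡e*v ⟨
  r * c / suc n       ∎)
  where open ≡-Reasoning

module _ {r c n : ℕ} (T : Design r c (suc n))
         (replicate : Equireplicate T ⊎ NearEquireplicate T) where

  replication-floorOrCeil : ∀ s → FloorOrCeil (replication T s) (r * c) (suc n)
  replication-floorOrCeil = [ equireplicate⇒floorOrCeil T , proj₂ ]′ replicate

  replication≤2 : r * c ≤ 2 * suc n → ∀ s → replication T s ≤ 2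
  replication≤2 rc≤2v s = floorOrCeil-≤ 2 rc≤2v (replication-floorOrCeil s)

  replication≥1⊎≤1 : (∀ s → 1 ≤ replication T s) ⊎ (∀ s → replication T s ≤ 1)
  replication≥1⊎≤1 with suc n ≤? r * c
  ... | yes v≤rc = inj₁ λ s → floorOrCeil-≥ 1 1*v≤rc (replication-floorOrCeil s)
    where
    1*v≤rc : 1 * suc n ≤ r * c
    1*v≤rc = ≤-trans (≤-reflexive (*-identityˡ (suc n))) v≤rc
  ... | no  v≰rc = inj₂ λ s → floorOrCeil-≤ 1 rc≤1*v (replication-floorOrCeil s)
    where
    rc≤1*v : r * c ≤ 1 * suc n
    rc≤1*v = ≤-trans (≰⇒≥ v≰rc) (≤-reflexive (sym (*-identityˡ (suc n))))

2*nC2≡n*[n∸1] : ∀ n → 2 * (n C 2) ≡ n * (n ∸ 1)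
2*nC2≡n*[n∸1] zero          = refl
2*nC2≡n*[n∸1] (suc zero)    = refl
2*nC2≡n*[n∸1] (suc (suc n)) = begin
  2 * (suc (suc n) C 2)           ≡⟨ cong (2 *_) ([1+n]C2≡n+nC2 (suc n)) ⟩
  2 * (suc n + suc n C 2)         ≡⟨ *-distribˡ-+ 2 (suc n) (suc n C 2) ⟩
  2 * suc n + 2 * (suc n C 2)     ≡⟨ cong (2 * suc n +_) (2*nC2≡n*[n∸1] (suc n)) ⟩
  2 * suc n + suc n * n           ≡⟨ expand n ⟩
  suc (suc n) * suc n             ∎
  where
  open ≡-Reasoning
  expand : ∀ n → 2 * suc n + suc n * n ≡ suc (suc n) * suc n
  expand = solve-∀

2*m≤n+m⇔m≤n : ∀ m n → 2 * m ≤ n + m ⇔ m ≤ n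
2*m≤n+m⇔m≤n m n = mk⇔
  (λ 2m≤n+m → +-cancelʳ-≤ m m n (subst (_≤ n + m) 2*m≡m+m 2m≤n+m))
  (λ m≤n → subst (_≤ n + m) (sym 2*m≡m+m) (+-monoˡ-≤ m m≤n))
  where
  2*m≡m+m : 2 * m ≡ m + m
  2*m≡m+m = cong (m +_) (+-identityʳ m)

≤⊓⇔ : ∀ {m n o} → m ≤ n ⊓ o ⇔ (m ≤ n × m ≤ o)
≤⊓⇔ {m} {n} {o} =
  mk⇔ (λ m≤n⊓o → m≤n⊓o⇒m≤n n o m≤n⊓o , m≤n⊓o⇒m≤o n o m≤n⊓o) (uncurry ⊓-glb)

conditionB⇔ : ∀ r c v →
  (2 * (r * c) ≤ 2 * v + c * (r ⊓ (c ∸ 1))) ⇔ (r * c ≤ 2 * v × r * c ≤ v + c C 2)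
conditionB⇔ r c v = mk⇔
  (λ h → let h₁ , h₂ = Equivalence.to ≤⊓⇔ (subst (2 * (r * c) ≤_) bound h)
         in Equivalence.to (2*m≤n+m⇔m≤n (r * c) (2 * v)) h₁ , *-cancelˡ-≤ 2 h₂)
  (λ (h₁ , h₂) → subst (2 * (r * c) ≤_) (sym bound)
    (⊓-glb (Equivalence.from (2*m≤n+m⇔m≤n (r * c) (2 * v)) h₁) (*-monoʳ-≤ 2 h₂)))
  where
  open ≡-Reasoning
  bound : 2 * v + c * (r ⊓ (c ∸ 1)) ≡ (2 * v + r * c) ⊓ (2 * (v + c C 2))
  bound = begin
    2 * v + c * (r ⊓ (c ∸ 1))
      ≡⟨ cong (2 * v +_) (*-distribˡ-⊓ c r (c ∸ 1)) ⟩
    2 * v + (c * r) ⊓ (c * (c ∸ 1))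
      ≡⟨ +-distribˡ-⊓ (2 * v) (c * r) (c * (c ∸ 1)) ⟩
    (2 * v + c * r) ⊓ (2 * v + c * (c ∸ 1))
      ≡⟨ cong₂ (λ x y → (2 * v + x) ⊓ (2 * v + y)) (*-comm r c) (2*nC2≡n*[n∸1] c) ⟨
    (2 * v + r * c) ⊓ (2 * v + 2 * (c C 2))
      ≡⟨ cong ((2 * v + r * c) ⊓_) (*-distribˡ-+ 2 v (c C 2)) ⟨
    (2 * v + r * c) ⊓ (2 * (v + c C 2))
      ∎

conditionA⇔ : ∀ {r c n} (T : Design r c (suc n)) →
  Binary T → Equireplicate T ⊎ NearEquireplicate T →
  ConditionA T ⇔ (r * c ≤ 2 * suc n × r * c ≤ suc n + c C 2)
conditionA⇔ {r} {c} {n} T binary replicate = mk⇔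
  (λ (rc≤2v , _ , sumCC≤cC2) →
    rc≤2v , ≤-trans (rc≤v+sumCC T binary) (+-monoʳ-≤ (suc n) sumCC≤cC2))
  (λ (rc≤2v , rc≤v+cC2) →
    let ρ≤2 = replication≤2 T replicate rc≤2v
    in rc≤2v , sumRC≤2rc T binary ρ≤2 ,
       sumCC≤cC2 ρ≤2 rc≤v+cC2 (replication≥1⊎≤1 T replicate))
  where
  sumCC≤cC2 : (∀ s → replication T s ≤ 2) → r * c ≤ suc n + c C 2 →
    (∀ s → 1 ≤ replication T s) ⊎ (∀ s → replication T s ≤ 1) → sumCC T ≤ c C 2
  sumCC≤cC2 ρ≤2 rc≤v+cC2 (inj₁ 1≤ρ) = +-cancelˡ-≤ (suc n) _ _
    (subst (_≤ suc n + c C 2) (sym (v+sumCC≡rc T binary 1≤ρ ρ≤2)) rc≤v+cC2)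
  sumCC≤cC2 _ _ (inj₂ ρ≤1) = subst (_≤ c C 2) (sym (sumCC≡0 T binary ρ≤1)) z≤n

lemma5p1 : (r c v : ℕ) → 2 ≤ r → 2 ≤ c → (T : Design r c v) →
    NearTripleArray T → (ConditionA T ⇔ ConditionB T)
lemma5p1 r c (suc n) _ _ T (binary , replicate , _) =
  ⇔-sym (conditionB⇔ r c (suc n)) ⇔-∘ conditionA⇔ T binary replicate
lemma5p1 (suc _) (suc _) zero _ _ T _ = contradiction (T zero zero) ¬Fin0
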